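{- Let $k\ge 2$, let $G$ be a graph with minimum degree at least $k$, and let $L=(P,C)$ be an optimal lollipop of $G$ with $C=c_1\dots c_tc_1$. If $R$ is a subpath of $C$ all of whose edges are passive and $u$ is an active vertex, then $u$ has at most one neighbor in $V(R)$, and such a neighbor (if it exists) is an end of $R$.
   Context: All graphs are finite and simple. A path is a sequence $p_1\dots p_s$ of distinct vertices with consecutive vertices adjacent; a cycle is a sequence $c_1\dots c_t c_1$ ($t\ge 3$) of distinct vertices with consecutive vertices (indices mod $t$) adjacent; its length is its number of edges. A chord of a path/cycle is an edge of $G$ between two of its vertices that is not one of its edges. For a path $Q$ and vertices $a,b$ on $Q$, $aQb$ denotes the subpath of $Q$ from $a$ to $b$. A lollipop in $G$ is a pair $L=(P,C)$ where $P=p_1\dots p_s$ ($s\geq 1$) is a path, $C=c_1\dots c_tc_1$ ($t\geq 3$) is a cycle, $p_s=c_1$ and $V(P)\cap V(C)=\{c_1\}$; $V(L)=V(P)\cup V(C)$. $L=(P,C)$ is optimal if no lollipop $L'$ satisfies $V(L)\subsetneq V(L')$, and no lollipop $L'=(P',C')$ with $V(L')=V(L)$ has $C'$ longer than $C$. Sets $\mathcal S_i$ of Hamiltonian paths of $G[V(C)]$ starting at $c_1$: $\mathcal S_1=\{c_1c_2\dots c_t,\ c_1c_tc_{t-1}\dots c_2\}$; for $i\ge 1$, $\mathcal S_{i+1}$ is the set of all paths obtained as follows: for each $Q=c_1\dots u\in\mathcal S_i$ and each vertex $v$ such that $uv$ is a chord of $Q$, let $w$ be the neighbor of $v$ on $vQu$;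 if $vw$ is an edge of $C$, then $c_1QvuQw$ is put in $\mathcal S_{i+1}$. A path is active if it belongs to $\mathcal S_i$ for some $i\ge 1$. A vertex $u\neq c_1$ is active if it is the end (other than $c_1$) of an active path; $c_1$ is not active. An edge of $C$ is passive if neither of its ends is active. -}

module Defs where

open import Data.Nat using (ℕ; _≤_; _<_)
open import Data.Fin using (Fin)
open import Data.List using (List; []; _∷_; _++_; length; filter; reverse)
open import Data.List.Membership.Propositional using (_∈_; _∉_)
open import Data.List.Relation.Unary.Unique.Propositional using (Unique)
open import Data.Fin.Base using ()
open import Data.List using (allFin)
open import Data.Product using (Σ; ∃; _×_; _,_)
open import Data.Sum using (_⊎_)
open import Relation.Nullary using (¬_; Dec)
open import Relation.Binary.PropositionalEquality using (_≡_; _≢_)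

record Graph (n : ℕ) : Set₁ where
  field
    E     : Fin n → Fin n → Set
    E?    : (u v : Fin n) → Dec (E u v)
    sym   : ∀ {u v} → E u v → E v u
    irrefl : ∀ {u} → ¬ E u u

module _ {n : ℕ} (G : Graph n) where
  open Graph G

  V : Set
  V = Fin n

  degree : V → ℕ
  degree v = length (filter (E? v) (allFin n))

  MinDegreeAtLeast : ℕ → Set
  MinDegreeAtLeast k = ∀ v → k ≤ degree v

  data Chain (R : V → V → Set) : List V → Set where
    []  : Chain R []
    [_] : ∀ x → Chain R (x ∷ [])
    _∷_ : ∀ {x y l} → R x y → Chain R (y ∷ l) → Chain R (x ∷ y ∷ l)

  IsPath : List V → Set
  IsPath l = 1 ≤ length l × Unique l × Chain E l

  -- the cycle c ∷ cs closed back to c, i.e. c₁ c₂ … c_t c₁ with t = 1 + length cs ≥ 3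
  IsCycle : V → List V → Set
  IsCycle c cs = 2 ≤ length cs × Unique (c ∷ cs) × Chain E (c ∷ cs ++ c ∷ [])

  -- A lollipop (P, C): the path P is  ps ++ [c₁]  (so p_s = c₁), the cycle C is c₁ ∷ cs.
  record Lollipop : Set where
    field
      ps    : List V
      c₁    : V
      cs    : List V
      path  : IsPath (ps ++ c₁ ∷ [])
      cycle : IsCycle c₁ cs
      disj  : ∀ x → x ∈ ps → x ∉ c₁ ∷ cs

  VL : Lollipop → List V
  VL L = Lollipop.ps L ++ Lollipop.c₁ L ∷ Lollipop.cs L

  _⊆V_ : Lollipop → Lollipop → Set
  L ⊆V L' = ∀ x → x ∈ VL L → x ∈ VL L'

  cycLen : Lollipop → ℕ
  cycLen L = 1 Data.Nat.+ length (Lollipop.cs L)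

  Optimal : Lollipop → Set
  Optimal L =
    (∀ (L' : Lollipop) → L ⊆V L' → ¬ (∃ λ x → x ∈ VL L' × x ∉ VL L)) ×
    (∀ (L' : Lollipop) → L ⊆V L' → L' ⊆V L → ¬ (cycLen L < cycLen L'))

  data Consec : List V → V → V → Set where
    here  : ∀ {x y l} → Consec (x ∷ y ∷ l) x y
    there : ∀ {z l x y} → Consec l x y → Consec (z ∷ l) x y

  CycEdge : V → List V → V → V → Set
  CycEdge c cs a b = Consec (c ∷ cs ++ c ∷ []) a b ⊎ Consec (c ∷ cs ++ c ∷ []) b a

  -- Step: Q = A ++ v ∷ w ∷ M ++ [u] (so v is not the predecessor of u, hence uv is a chord
  -- of Q exactly when E u v), w is the neighbor of v on vQu; if vw is an edge of C then
  -- c₁QvuQw = A ++ v ∷ reverse (w ∷ M ++ [u]) is active.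
  data ActivePath (c : V) (cs : List V) : List V → Set where
    base₁ : ActivePath c cs (c ∷ cs)
    base₂ : ActivePath c cs (c ∷ reverse cs)
    step  : ∀ A v w M u →
            ActivePath c cs (A ++ v ∷ w ∷ M ++ u ∷ []) →
            E u v → CycEdge c cs v w →
            ActivePath c cs (A ++ v ∷ reverse (w ∷ M ++ u ∷ []))

  ActiveVertex : V → List V → V → Set
  ActiveVertex c cs u = u ≢ c × ∃ λ Q → ActivePath c cs Q × ∃ λ A → Q ≡ A ++ u ∷ []

  SubpathOfCycle : V → List V → List V → Set
  SubpathOfCycle c cs R = Unique R × Chain (CycEdge c cs) R

  AllEdgesPassive : V → List V → List V → Set
  AllEdgesPassive c cs R = Chain (λ a b → ¬ ActiveVertex c cs a × ¬ ActiveVertex c cs b) R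

-- Every active path Q is a Hamiltonian path of the cycle, and the only
-- way a cycle edge with two passive ends can stop being an edge of the
-- current path is by a rotation that makes one of its ends active. Hence
-- every passive edge of C is an edge of Q, so R is a segment of Q,
-- traversed either forwards or backwards. If the end u of Q is adjacent
-- to x ∈ R and w is a neighbour of x on R, then w precedes x on Q: were
-- it the other way round, rotating Q at the chord ux would make w active.
-- So every neighbour of u on R lies at the same end of R.

module Submission where

open import Defs
open import Data.Nat using (ℕ; _≤_)
open import Data.List using (List; _∷_; []; _++_; reverse; _ʳ++_)
open import Data.List.Properties using (++-assoc; ∷-injectiveˡ; ∷ʳ-injectiveʳ; unfold-reverse; reverse-++)
open import Data.List.Membership.Propositional using (_∈_)
open import Data.List.Relation.Unary.Any using (here; there)
open import Data.List.Relation.Unary.All using (_∷_)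
open import Data.List.Relation.Unary.AllPairs using (_∷_)
open import Data.List.Relation.Unary.Unique.Propositional using (Unique)
open import Data.List.Relation.Unary.Unique.Propositional.Properties using (Unique[x∷xs]⇒x∉xs)
open import Data.List.Relation.Binary.Permutation.Propositional using (_↭_; ↭-refl; ↭-prep; ↭-sym; ↭-trans; ↭⇒↭ₛ)
open import Data.List.Relation.Binary.Permutation.Propositional.Properties using (↭-reverse; ++⁺ˡ)
import Data.List.Relation.Binary.Permutation.Setoid.Properties as Permutationₛ
open import Data.Product using (_×_; ∃; ∃₂; _,_; proj₁; proj₂)
open import Data.Sum using (_⊎_; inj₁; inj₂; swap; map₁)
import Data.Sum
open import Function using (flip; _∘_)
open import Relation.Nullary using (¬_; contradiction)
open import Relation.Binary.Definitions using (Asymmetric)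
open import Relation.Binary.Rewriting using (Deterministic)
open import Relation.Binary.PropositionalEquality using (_≡_; _≢_; refl; sym; trans; cong; subst; setoid; module ≡-Reasoning)

Unique-resp-↭ : ∀ {a} {A : Set a} {xs ys : List A} → xs ↭ ys → Unique xs → Unique ys
Unique-resp-↭ {A = A} p = Permutationₛ.Unique-resp-↭ (setoid A) (↭⇒↭ₛ p)

module _ {n : ℕ} {G : Graph n} where

  private
    variable
      a b x y z : V G
      l xs ys : List (V G)

  Adjacent : List (V G) → V G → V G → Set
  Adjacent l a b = Consec G l a b ⊎ Consec G l b a

  Consec-∈ˡ : Consec G l a b → a ∈ l
  Consec-∈ˡ here      = here refl
  Consec-∈ˡ (there p) = there (Consec-∈ˡ p)

  Consec-∈ʳ : Consec G l a b → b ∈ l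
  Consec-∈ʳ here      = there (here refl)
  Consec-∈ʳ (there p) = there (Consec-∈ʳ p)

  Consec-∷-∈ʳ : Consec G (x ∷ l) a b → b ∈ l
  Consec-∷-∈ʳ here      = here refl
  Consec-∷-∈ʳ (there p) = Consec-∈ʳ p

  Consec-∷-≢ : Unique (x ∷ l) → Consec G (x ∷ l) a b → b ≢ x
  Consec-∷-≢ u p refl = Unique[x∷xs]⇒x∉xs u (Consec-∷-∈ʳ p)

  Consec-deterministic : Unique l → Deterministic _≡_ (Consec G l)
  Consec-deterministic _       here      here      = refl
  Consec-deterministic u       here      (there q) = contradiction (Consec-∈ˡ q) (Unique[x∷xs]⇒x∉xs u)
  Consec-deterministic u       (there p) here      = contradiction (Consec-∈ˡ p) (Unique[x∷xs]⇒x∉xs u)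
  Consec-deterministic (_ ∷ u) (there p) (there q) = Consec-deterministic u p q

  Consec-deterministicˡ : Unique l → Deterministic _≡_ (flip (Consec G l))
  Consec-deterministicˡ _       here      here      = refl
  Consec-deterministicˡ (_ ∷ u) here      (there q) = contradiction (Consec-∷-∈ʳ q) (Unique[x∷xs]⇒x∉xs u)
  Consec-deterministicˡ (_ ∷ u) (there p) here      = contradiction (Consec-∷-∈ʳ p) (Unique[x∷xs]⇒x∉xs u)
  Consec-deterministicˡ (_ ∷ u) (there p) (there q) = Consec-deterministicˡ u p q

  Consec-asym : Unique l → Asymmetric (Consec G l)
  Consec-asym u       here      here      = Unique[x∷xs]⇒x∉xs u (here refl)
  Consec-asym u       here      (there q) = Unique[x∷xs]⇒x∉xs u (there (Consec-∷-∈ʳ q))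
  Consec-asym u       (there p) here      = Unique[x∷xs]⇒x∉xs u (there (Consec-∷-∈ʳ p))
  Consec-asym (_ ∷ u) (there p) (there q) = Consec-asym u p q

  Consec-++⁺ˡ : ∀ ys → Consec G xs a b → Consec G (xs ++ ys) a b
  Consec-++⁺ˡ ys here      = here
  Consec-++⁺ˡ ys (there p) = there (Consec-++⁺ˡ ys p)

  Consec-++⁺ʳ : ∀ xs → Consec G ys a b → Consec G (xs ++ ys) a b
  Consec-++⁺ʳ []       p = p
  Consec-++⁺ʳ (x ∷ xs) p = there (Consec-++⁺ʳ xs p)

  Consec-ʳ++⁺ʳ : ∀ xs → Consec G ys a b → Consec G (xs ʳ++ ys) a b
  Consec-ʳ++⁺ʳ []       p = p
  Consec-ʳ++⁺ʳ (x ∷ xs) p = Consec-ʳ++⁺ʳ xs (there p)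

  Consec-ʳ++⁺ˡ : Consec G xs a b → Consec G (xs ʳ++ ys) b a
  Consec-ʳ++⁺ˡ {xs = _ ∷ _ ∷ xs} here = Consec-ʳ++⁺ʳ xs here
  Consec-ʳ++⁺ˡ (there p)             = Consec-ʳ++⁺ˡ p

  Consec-reverse : Consec G xs a b → Consec G (reverse xs) b a
  Consec-reverse = Consec-ʳ++⁺ˡ

  Consec⇒++ : Consec G l a b → ∃₂ λ A T → l ≡ A ++ a ∷ b ∷ T
  Consec⇒++ {l = _ ∷ _ ∷ T} here = [] , T , refl
  Consec⇒++ {l = x ∷ _} (there p) with A , T , eq ← Consec⇒++ p = x ∷ A , T , cong (x ∷_) eq

  Consec-∷ʳ⁻ : ∀ l → Consec G (l ++ z ∷ []) a b →
               Consec G l a b ⊎ (b ≡ z × ∃ λ A → l ≡ A ++ a ∷ [])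
  Consec-∷ʳ⁻ []          (there ())
  Consec-∷ʳ⁻ (x ∷ [])    here              = inj₂ (refl , [] , refl)
  Consec-∷ʳ⁻ (x ∷ [])    (there (there ()))
  Consec-∷ʳ⁻ (x ∷ y ∷ l) here              = inj₁ here
  Consec-∷ʳ⁻ (x ∷ y ∷ l) (there p)         =
    Data.Sum.map there (λ (e , A , eq) → e , x ∷ A , cong (x ∷_) eq) (Consec-∷ʳ⁻ (y ∷ l) p)

  Consec-middle⁻ : ∀ A {v w T} → Consec G (A ++ v ∷ w ∷ T) a b →
                   Consec G (A ++ v ∷ []) a b ⊎ (a ≡ v × b ≡ w) ⊎ Consec G (w ∷ T) a b
  Consec-middle⁻ []           here      = inj₂ (inj₁ (refl , refl))
  Consec-middle⁻ []           (there p) = inj₂ (inj₂ p)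
  Consec-middle⁻ (x ∷ [])     here      = inj₁ here
  Consec-middle⁻ (x ∷ _ ∷ _)  here      = inj₁ here
  Consec-middle⁻ (x ∷ A)      (there p) = map₁ there (Consec-middle⁻ A p)

  ∈⇒∷ʳ⊎Consec : x ∈ l → (∃ λ A → l ≡ A ++ x ∷ []) ⊎ ∃ (Consec G l x)
  ∈⇒∷ʳ⊎Consec {l = _ ∷ []}    (here refl) = inj₁ ([] , refl)
  ∈⇒∷ʳ⊎Consec {l = _ ∷ y ∷ _} (here refl) = inj₂ (y , here)
  ∈⇒∷ʳ⊎Consec {l = z ∷ _}     (there m)   =
    Data.Sum.map (λ (A , eq) → z ∷ A , cong (z ∷_) eq) (λ (y , p) → y , there p) (∈⇒∷ʳ⊎Consec m)

  ∈⇒≡⊎Consec : x ∈ y ∷ l → x ≡ y ⊎ ∃ λ z → Consec G (y ∷ l) z x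
  ∈⇒≡⊎Consec (here refl) = inj₁ refl
  ∈⇒≡⊎Consec {l = z ∷ _} (there m) with ∈⇒≡⊎Consec m
  ... | inj₁ refl       = inj₂ (_ , here)
  ... | inj₂ (w , p)    = inj₂ (w , there p)

  Chain-lookup : ∀ {R : V G → V G → Set} → Chain G R l → Consec G l a b → R a b
  Chain-lookup (r ∷ _)  here      = r
  Chain-lookup (_ ∷ ch) (there p) = Chain-lookup ch p

  Chain-zipWith : ∀ {R S T : V G → V G → Set} → (∀ {a b} → R a b → S a b → T a b) →
                  Chain G R l → Chain G S l → Chain G T l
  Chain-zipWith f []       []        = []
  Chain-zipWith f [ x ]    [ .x ]    = [ x ]
  Chain-zipWith f (r ∷ ch) (s ∷ ch′) = f r s ∷ Chain-zipWith f ch ch′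

  module _ {_≺_ : V G → V G → Set} where

    Chain-oriented : Deterministic _≡_ _≺_ → Deterministic _≡_ (flip _≺_) → Unique l →
                     Chain G (λ a b → a ≺ b ⊎ b ≺ a) l → Chain G _≺_ l ⊎ Chain G (flip _≺_) l
    Chain-oriented det det′ _ []                   = inj₁ []
    Chain-oriented det det′ _ [ x ]                = inj₁ [ x ]
    Chain-oriented det det′ _ (inj₁ p ∷ [ y ])     = inj₁ (p ∷ [ y ])
    Chain-oriented det det′ _ (inj₂ p ∷ [ y ])     = inj₂ (p ∷ [ y ])
    Chain-oriented det det′ ((_ ∷ x≢z ∷ _) ∷ u) (o ∷ ch@(_ ∷ _)) with Chain-oriented det det′ u ch | o
    ... | inj₁ ch′@(q ∷ _) | inj₁ p = inj₁ (p ∷ ch′)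
    ... | inj₁ (q ∷ _)     | inj₂ p = contradiction (det p q) x≢z
    ... | inj₂ ch′@(q ∷ _) | inj₂ p = inj₂ (p ∷ ch′)
    ... | inj₂ (q ∷ _)     | inj₁ p = contradiction (det′ p q) x≢z

    Chain-∈⇒∷ʳ : Asymmetric _≺_ → Chain G _≺_ l → x ∈ l → (∀ {y} → Consec G l x y → y ≺ x) →
                 ∃ λ A → l ≡ A ++ x ∷ []
    Chain-∈⇒∷ʳ asym ch m back with ∈⇒∷ʳ⊎Consec m
    ... | inj₁ last    = last
    ... | inj₂ (_ , p) = contradiction (back p) (asym (Chain-lookup ch p))

    Chain-∈⇒≡head : Asymmetric _≺_ → Chain G (flip _≺_) (y ∷ l) → x ∈ y ∷ l →
                    (∀ {z} → Consec G (y ∷ l) z x → z ≺ x) → x ≡ y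
    Chain-∈⇒≡head asym ch m back with ∈⇒≡⊎Consec m
    ... | inj₁ first   = first
    ... | inj₂ (_ , p) = contradiction (back p) (asym (Chain-lookup ch p))

    at-one-end : Deterministic _≡_ _≺_ → Deterministic _≡_ (flip _≺_) → Asymmetric _≺_ →
                 ∀ {r rs} → Unique (r ∷ rs) → Chain G (λ a b → a ≺ b ⊎ b ≺ a) (r ∷ rs) →
                 (S : V G → Set) → (∀ {x y} → S x → Adjacent (r ∷ rs) x y → y ≺ x) →
                 (∀ {x} → x ∈ r ∷ rs → S x → x ≡ r) ⊎
                 (∀ {x} → x ∈ r ∷ rs → S x → ∃ λ A → r ∷ rs ≡ A ++ x ∷ [])
    at-one-end det det′ asym u ch S back with Chain-oriented det det′ u ch
    ... | inj₁ forward  = inj₂ λ m s → Chain-∈⇒∷ʳ asym forward m (back s ∘ inj₁)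
    ... | inj₂ backward = inj₁ λ m s → Chain-∈⇒≡head asym backward m (back s ∘ inj₂)

  one-end⇒unique-end : ∀ {r rs} {S : V G → Set} →
                       (∀ {x} → x ∈ r ∷ rs → S x → x ≡ r) ⊎
                       (∀ {x} → x ∈ r ∷ rs → S x → ∃ λ A → r ∷ rs ≡ A ++ x ∷ []) →
                       (∀ x y → x ∈ r ∷ rs → y ∈ r ∷ rs → S x → S y → x ≡ y) ×
                       (∀ x → x ∈ r ∷ rs → S x → x ≡ r ⊎ ∃ λ A → r ∷ rs ≡ A ++ x ∷ [])
  one-end⇒unique-end (inj₁ first) =
    (λ _ _ mx my sx sy → trans (first mx sx) (sym (first my sy))) ,
    (λ _ m s → inj₁ (first m s))
  one-end⇒unique-end (inj₂ last) =
    (λ _ _ mx my sx sy → ∷ʳ-injectiveʳ _ _ (trans (sym (last mx sx .proj₂)) (last my sy .proj₂))) ,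
    (λ _ m s → inj₂ (last m s))

module Active {n : ℕ} (G : Graph n) (c : V G) (cs : List (V G)) where
  open Graph G using (E; irrefl) renaming (sym to E-sym)

  private
    variable
      a b : V G
      Q : List (V G)

  ActivePath-↭ : ActivePath G c cs Q → c ∷ cs ↭ Q
  ActivePath-↭ base₁                   = ↭-refl
  ActivePath-↭ base₂                   = ↭-prep c (↭-sym (↭-reverse cs))
  ActivePath-↭ (step A v w M u act _ _) =
    ↭-trans (ActivePath-↭ act) (++⁺ˡ A (↭-prep v (↭-sym (↭-reverse (w ∷ M ++ u ∷ [])))))

  ActivePath-head : ActivePath G c cs Q → ∃ λ T → Q ≡ c ∷ T
  ActivePath-head base₁ = cs , refl
  ActivePath-head base₂ = reverse cs , refl
  ActivePath-head (step [] v w M u act _ _) with _ , eq ← ActivePath-head act =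
    _ , cong (_∷ _) (∷-injectiveˡ eq)
  ActivePath-head (step (x ∷ A) v w M u act _ _) with _ , eq ← ActivePath-head act =
    _ , cong (_∷ _) (∷-injectiveˡ eq)

  closing-edge⁻ : ∀ {cs′} → ActivePath G c cs (c ∷ cs′) → E a b →
                  Consec G (c ∷ cs′ ++ c ∷ []) a b → ¬ ActiveVertex G c cs a →
                  Consec G (c ∷ cs′) a b
  closing-edge⁻ {cs′ = cs′} act ab p passive with Consec-∷ʳ⁻ (c ∷ cs′) p
  ... | inj₁ q               = q
  ... | inj₂ (refl , A , eq) = contradiction ((λ { refl → irrefl ab }) , _ , act , A , eq) passive

  Consec-closed-reverse : Consec G (c ∷ cs ++ c ∷ []) a b → Consec G (c ∷ reverse cs ++ c ∷ []) b a
  Consec-closed-reverse = subst (λ t → Consec G t _ _) reverse-closed ∘ Consec-reverse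
    where
    open ≡-Reasoning
    reverse-closed : reverse (c ∷ cs ++ c ∷ []) ≡ c ∷ reverse cs ++ c ∷ []
    reverse-closed = begin
      reverse (c ∷ cs ++ c ∷ [])       ≡⟨ unfold-reverse c (cs ++ c ∷ []) ⟩
      reverse (cs ++ c ∷ []) ++ c ∷ [] ≡⟨ cong (_++ c ∷ []) (reverse-++ cs (c ∷ [])) ⟩
      c ∷ reverse cs ++ c ∷ []         ∎

  module _ (cycle-unique : Unique (c ∷ cs)) where

    ActivePath-unique : ActivePath G c cs Q → Unique Q
    ActivePath-unique act = Unique-resp-↭ (ActivePath-↭ act) cycle-unique

    Consec-ActivePath-≢ : ActivePath G c cs Q → Consec G Q a b → b ≢ c
    Consec-ActivePath-≢ act p with _ , refl ← ActivePath-head act =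
      Consec-∷-≢ (ActivePath-unique act) p

    step-activates : ∀ A v w M u → ActivePath G c cs (A ++ v ∷ w ∷ M ++ u ∷ []) →
                     E u v → CycEdge G c cs v w → ActiveVertex G c cs w
    step-activates A v w M u act uv vw =
      Consec-ActivePath-≢ act (Consec-++⁺ʳ A here) ,
      _ , step A v w M u act uv vw , A ++ v ∷ reverse (M ++ u ∷ []) , rotated-ends-in-w
      where
      open ≡-Reasoning
      rotated-ends-in-w : A ++ v ∷ reverse (w ∷ M ++ u ∷ []) ≡ (A ++ v ∷ reverse (M ++ u ∷ [])) ++ w ∷ []
      rotated-ends-in-w = begin
        A ++ v ∷ reverse (w ∷ M ++ u ∷ [])       ≡⟨ cong (λ t → A ++ v ∷ t) (unfold-reverse w (M ++ u ∷ [])) ⟩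
        A ++ v ∷ reverse (M ++ u ∷ []) ++ w ∷ [] ≡⟨ ++-assoc A _ _ ⟨
        (A ++ v ∷ reverse (M ++ u ∷ [])) ++ w ∷ [] ∎

    step-preserves-Adjacent : ∀ A v w M u → ActivePath G c cs (A ++ v ∷ w ∷ M ++ u ∷ []) →
                              E u v → CycEdge G c cs v w →
                              Consec G (A ++ v ∷ w ∷ M ++ u ∷ []) a b → ¬ ActiveVertex G c cs b →
                              Adjacent (A ++ v ∷ reverse (w ∷ M ++ u ∷ [])) a b
    step-preserves-Adjacent A v w M u act uv vw p passive with Consec-middle⁻ A p
    ... | inj₁ q                  = inj₁ (subst (λ t → Consec G t _ _) (++-assoc A _ _) (Consec-++⁺ˡ _ q))
    ... | inj₂ (inj₁ (_ , refl))  = contradiction (step-activates A v w M u act uv vw) passive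
    ... | inj₂ (inj₂ q)           = inj₂ (Consec-++⁺ʳ A (there (Consec-reverse q)))

    module _ (cycle-closed : Chain G E (c ∷ cs ++ c ∷ [])) where

      passive-Adjacent : ActivePath G c cs Q → CycEdge G c cs a b →
                         ¬ ActiveVertex G c cs a → ¬ ActiveVertex G c cs b → Adjacent Q a b
      passive-Adjacent base₁ (inj₁ p) na nb =
        inj₁ (closing-edge⁻ base₁ (Chain-lookup cycle-closed p) p na)
      passive-Adjacent base₁ (inj₂ p) na nb =
        inj₂ (closing-edge⁻ base₁ (Chain-lookup cycle-closed p) p nb)
      passive-Adjacent base₂ (inj₁ p) na nb =
        inj₂ (closing-edge⁻ base₂ (E-sym (Chain-lookup cycle-closed p)) (Consec-closed-reverse p) nb)
      passive-Adjacent base₂ (inj₂ p) na nb =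
        inj₁ (closing-edge⁻ base₂ (E-sym (Chain-lookup cycle-closed p)) (Consec-closed-reverse p) na)
      passive-Adjacent (step A v w M u act uv vw) e na nb with passive-Adjacent act e na nb
      ... | inj₁ p = step-preserves-Adjacent A v w M u act uv vw p nb
      ... | inj₂ p = swap (step-preserves-Adjacent A v w M u act uv vw p na)

      neighbour-preceded : ∀ {u x w} B → ActivePath G c cs (B ++ u ∷ []) → ActiveVertex G c cs u →
                           E u x → CycEdge G c cs x w →
                           ¬ ActiveVertex G c cs x → ¬ ActiveVertex G c cs w →
                           Consec G (B ++ u ∷ []) w x
      neighbour-preceded B act u-active ux xw nx nw with passive-Adjacent act xw nx nw
      ... | inj₂ p = p
      ... | inj₁ p with Consec-∷ʳ⁻ B p
      ...   | inj₂ (refl , _) = contradiction u-active nw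
      ...   | inj₁ q with A , M , refl ← Consec⇒++ q =
        contradiction (step-activates A _ _ M _ (subst (ActivePath G c cs) (++-assoc A _ _) act) ux xw) nw

lemma7 : (k : ℕ) → 2 ≤ k → (n : ℕ) → (G : Graph n) → MinDegreeAtLeast G k →
         (L : Lollipop G) → Optimal G L →
         (r : V G) (rs : List (V G)) →
         SubpathOfCycle G (Lollipop.c₁ L) (Lollipop.cs L) (r ∷ rs) →
         AllEdgesPassive G (Lollipop.c₁ L) (Lollipop.cs L) (r ∷ rs) →
         (u : V G) → ActiveVertex G (Lollipop.c₁ L) (Lollipop.cs L) u →
         (∀ x y → x ∈ r ∷ rs → y ∈ r ∷ rs → Graph.E G u x → Graph.E G u y → x ≡ y) ×
         (∀ x → x ∈ r ∷ rs → Graph.E G u x → x ≡ r ⊎ ∃ λ A → r ∷ rs ≡ A ++ x ∷ [])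
lemma7 _ _ _ G _ L _ r rs (R-unique , R-cycle) R-passive u u-active@(_ , _ , Q-active , B , refl) =
  one-end⇒unique-end {G = G}
    (at-one-end {G = G} (Consec-deterministic Q-unique) (Consec-deterministicˡ Q-unique)
                (Consec-asym Q-unique) R-unique R-adjacent (Graph.E G u) preceded)
  where
  open Lollipop L using (c₁; cs; cycle)
  open Active G c₁ cs

  cycle-unique : Unique (c₁ ∷ cs)
  cycle-unique = cycle .proj₂ .proj₁

  cycle-closed : Chain G (Graph.E G) (c₁ ∷ cs ++ c₁ ∷ [])
  cycle-closed = cycle .proj₂ .proj₂

  Q-unique : Unique (B ++ u ∷ [])
  Q-unique = ActivePath-unique cycle-unique Q-active

  R-adjacent : Chain G (Adjacent {G = G} (B ++ u ∷ [])) (r ∷ rs)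
  R-adjacent = Chain-zipWith (λ e (na , nb) → passive-Adjacent cycle-unique cycle-closed Q-active e na nb)
                             R-cycle R-passive

  preceded : ∀ {x y} → Graph.E G u x → Adjacent {G = G} (r ∷ rs) x y → Consec G (B ++ u ∷ []) y x
  preceded ux (inj₁ p) with nx , ny ← Chain-lookup R-passive p =
    neighbour-preceded cycle-unique cycle-closed B Q-active u-active ux (Chain-lookup R-cycle p) nx ny
  preceded ux (inj₂ p) with ny , nx ← Chain-lookup R-passive p =
    neighbour-preceded cycle-unique cycle-closed B Q-active u-active ux (swap (Chain-lookup R-cycle p)) nx ny
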